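{- The partial order $\succ$ is preserved under the Jacquet--Langlands correspondence $\mathbf{G}$, that is, for any pair of triples in $\mathcal{M}'$ with third entries $\underline{z}_1'$ and $\underline{z}_2'$, we have that $$ \iota'(\underline{z}_1')\succ \iota'(\underline{z}_2') $$ if and only if $$ \iota(\mathbf{G}(\underline{z}_1'))\succ \iota (\mathbf{G}(\underline{z}_2')). $$
   Context: Let $F$ be a number field with adèles $\mathbb{A}$, let $D$ be a central division algebra of degree $d>1$ over $F$, let $G_n'$ be the general linear group of $n\times n$ matrices over $D$ (an inner form of $G_{nd}=GL_{nd}$ over $F$). Fix a cuspidal support for $G_n'(\mathbb{A})$ and let $\mathcal{M}'$ be the set of triples $(R',\Pi',\underline{z}')$ attached to it, where $R'$ is a standard parabolic subgroup of $G_n'$ corresponding to an ordered partition $(n_1,\dots,n_r)$ of $n$, $\Pi'$ is a unitary discrete spectrum representation of its Levi factor, and $\underline{z}'=(z_1,\dots,z_r)$ is a real $r$-tuple with $z_1\geq\dots\geq z_r$ and $\sum_j n_jz_j=0$, viewed in $\check{\mathfrak{a}}_{R'}^{G_n'}$. The inclusion $\iota'$ into $\check{\mathfrak{a}}_{P_0'}^{G_n'}$ (minimal parabolic) is $\iota'(\underline{z}')=(\zeta_1,\dots,\zeta_n)=(z_1,\dots,z_1,\dots,z_r,\dots,z_r)$ with $z_j$ repeated $n_j$ times. The Jacquet--Langlands transfer $\mathbf{G}(\underline{z}')$ is the same $r$-tuple viewed as an element of $\check{\mathfrak{a}}_{R}^{G_{nd}}$, where $R$ is the parabolic subgroup of $G_{nd}$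 corresponding to the partition $(n_1d,\dots,n_rd)$ of $nd$; hence its inclusion into $\check{\mathfrak{a}}_{P_0}^{G_{nd}}$ is $\iota(\mathbf{G}(\underline{z}'))=(\zeta_1,\dots,\zeta_1,\zeta_2,\dots,\zeta_2,\dots,\zeta_n,\dots,\zeta_n)$ with each $\zeta_j$ appearing $d$ times. The partial order $\succ$ on these spaces (coordinates $(s_1,\dots,s_N)$) is defined by: $\underline{s}\succ\underline{t}$ if and only if $\underline{s}\neq\underline{t}$ and $s_1+\dots+s_k\leq t_1+\dots+t_k$ for all $k=1,\dots,N-1$. -}

module Defs where

open import Level using (Level; _⊔_; suc)
open import Data.Nat as ℕ using (ℕ; zero)
open import Data.List using (List; []; _∷_; length; take; foldr; concat; zipWith; replicate; map)
open import Data.List.Relation.Unary.All using (All)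
open import Data.List.Relation.Unary.Linked using (Linked)
open import Data.List.Relation.Binary.Pointwise using (Pointwise)
open import Data.Product using (_×_)
open import Relation.Nullary using (¬_)
open import Relation.Binary.Core using (Rel)
open import Relation.Binary.Structures using (IsTotalOrder)
open import Relation.Binary.PropositionalEquality using (_≡_)
open import Algebra.Bundles using (CommutativeRing)

-- The real numbers
-- (which agda-stdlib lacks) are an instance; the statement is quantified
-- over all such structures.
record OrderedCommRing (c ℓ₁ ℓ₂ : Level) : Set (suc (c ⊔ ℓ₁ ⊔ ℓ₂)) where
  field
    commutativeRing : CommutativeRing c ℓ₁
  open CommutativeRing commutativeRing public
  field
    _≤_         : Rel Carrier ℓ₂
    isTotalOrder : IsTotalOrder _≈_ _≤_
  _<_ : Rel Carrier (ℓ₁ ⊔ ℓ₂)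
  x < y = (x ≤ y) × ¬ (x ≈ y)
  field
    +-mono-≤   : ∀ {x y} z → x ≤ y → (x + z) ≤ (y + z)
    0<1        : 0# < 1#
    *-pos      : ∀ {x y} → 0# < x → 0# < y → 0# < (x * y)

module _ {c ℓ₁ ℓ₂} (R : OrderedCommRing c ℓ₁ ℓ₂) where
  open OrderedCommRing R

  _•_ : ℕ → Carrier → Carrier
  zero    • x = 0#
  ℕ.suc n • x = x + (n • x)

  Σ : List Carrier → Carrier
  Σ = foldr _+_ 0#

  weightedSum : List ℕ → List Carrier → Carrier
  weightedSum p z = Σ (zipWith _•_ p z)

  -- Inclusion of 𝔞_R into 𝔞_{P_0} for the parabolic with block sizes p:
  -- (z₁,…,z_r) ↦ (z₁ repeated p₁ times, …, z_r repeated p_r times).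
  incl : List ℕ → List Carrier → List Carrier
  incl p z = concat (zipWith replicate p z)

  _≻_ : List Carrier → List Carrier → Set (c ⊔ ℓ₁ ⊔ ℓ₂)
  s ≻ t = ¬ Pointwise _≈_ s t
        × (∀ k → 1 ℕ.≤ k → k ℕ.< length s → Σ (take k s) ≤ Σ (take k t))

  -- The data (partition (n₁,…,n_r) of n, real r-tuple z) of a triple in 𝓜'
  -- relevant for the statement.
  record Admissible (n : ℕ) (p : List ℕ) (z : List Carrier) : Set (c ⊔ ℓ₁ ⊔ ℓ₂) where
    field
      parts-pos  : All (0 ℕ.<_) p
      parts-sum  : foldr ℕ._+_ 0 p ≡ n
      len        : length z ≡ length p
      decreasing : Linked (λ a b → b ≤ a) z
      weighted-0 : weightedSum p z ≈ 0#

  ι′ : List ℕ → List Carrier → List Carrier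
  ι′ = incl

  -- ι(G(z)): G(z) is the same tuple for the partition (n₁d,…,n_rd) of nd
  ιG : ℕ → List ℕ → List Carrier → List Carrier
  ιG d p z = incl (map (ℕ._* d) p) z

-- ι(G(z)) is ι'(z) with every coordinate repeated d times, and the vectors
-- compared have equal length and total sum 0.  At the block boundaries qd the
-- prefix sums of the stretched vectors are d times those of the original ones,
-- which gives ⇐ after cancelling d.  For ⇒, the equal totals make ≻ bound all
-- prefix sums, and inside a block the prefix sums of the stretched vectors are
-- affine in the position; an inequality between affine functions that holds at
-- both ends of an interval holds throughout.
module Submission where

open import Defs
open import Level using (Level)
open import Data.Nat using (ℕ; _<_)
open import Data.List using (List)
open import Function.Bundles using (_⇔_)

open import Data.Nat as ℕ using (zero; suc; NonZero; z≤n; s≤s)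
import Data.Nat.Properties as ℕ
open import Data.List using ([]; _∷_; _++_; take; replicate; length; map; concatMap; foldr)
open import Data.List.Properties using (length-++; length-replicate; concatMap-++; take-[]; take-all)
open import Data.List.Relation.Binary.Pointwise as Pointwise using (Pointwise; []; _∷_)
open import Data.Product using (_,_)
open import Data.Sum using (inj₁; inj₂)
open import Function.Base using (_∘_)
open import Function.Bundles using (mk⇔)
open import Relation.Binary.Core using (Rel)
open import Relation.Binary.PropositionalEquality as ≡ using (_≡_; cong; cong₂)
open import Relation.Binary.Structures using (IsTotalOrder)
open import Relation.Nullary using (yes; no)

module _ {a} {A : Set a} where

  repeatEach : ℕ → List A → List A
  repeatEach d = concatMap (replicate d)

  replicate-+ : ∀ m n (x : A) → replicate (m ℕ.+ n) x ≡ replicate m x ++ replicate n x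
  replicate-+ zero    n x = ≡.refl
  replicate-+ (suc m) n x = cong (x ∷_) (replicate-+ m n x)

  replicate-* : ∀ m d (x : A) → replicate (m ℕ.* d) x ≡ repeatEach d (replicate m x)
  replicate-* zero    d x = ≡.refl
  replicate-* (suc m) d x =
    ≡.trans (replicate-+ d (m ℕ.* d) x) (cong (replicate d x ++_) (replicate-* m d x))

  length-repeatEach : ∀ d (xs : List A) → length (repeatEach d xs) ≡ length xs ℕ.* d
  length-repeatEach d []       = ≡.refl
  length-repeatEach d (x ∷ xs) =
    ≡.trans (length-++ (replicate d x)) (cong₂ ℕ._+_ (length-replicate d) (length-repeatEach d xs))

  take-replicate-++ : ∀ {k m} (x : A) ys → k ℕ.≤ m → take k (replicate m x ++ ys) ≡ replicate k x
  take-replicate-++ {zero}          x ys _         = ≡.refl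
  take-replicate-++ {suc k} {suc m} x ys (s≤s k≤m) = cong (x ∷_) (take-replicate-++ x ys k≤m)

  take-replicate-++-+ : ∀ m k (x : A) ys → take (m ℕ.+ k) (replicate m x ++ ys) ≡ replicate m x ++ take k ys
  take-replicate-++-+ zero    k x ys = ≡.refl
  take-replicate-++-+ (suc m) k x ys = cong (x ∷_) (take-replicate-++-+ m k x ys)

  take-repeatEach : ∀ d q (xs : List A) → take (q ℕ.* d) (repeatEach d xs) ≡ repeatEach d (take q xs)
  take-repeatEach d zero    xs       = ≡.refl
  take-repeatEach d (suc q) []       = take-[] (d ℕ.+ q ℕ.* d)
  take-repeatEach d (suc q) (x ∷ xs) =
    ≡.trans (take-replicate-++-+ d (q ℕ.* d) x (repeatEach d xs))
            (cong (replicate d x ++_) (take-repeatEach d q xs))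

  module _ {r} {_∼_ : Rel A r} where

    repeatEach⁺ : ∀ d {xs ys} → Pointwise _∼_ xs ys → Pointwise _∼_ (repeatEach d xs) (repeatEach d ys)
    repeatEach⁺ d []         = []
    repeatEach⁺ d (x∼y ∷ xs∼ys) = Pointwise.++⁺ (Pointwise.replicate⁺ x∼y d) (repeatEach⁺ d xs∼ys)

    replicate-++-cancelˡ : ∀ m {x y us vs} →
      Pointwise _∼_ (replicate m x ++ us) (replicate m y ++ vs) → Pointwise _∼_ us vs
    replicate-++-cancelˡ zero    us∼vs       = us∼vs
    replicate-++-cancelˡ (suc m) (_ ∷ us∼vs) = replicate-++-cancelˡ m us∼vs

    repeatEach⁻ : ∀ d .{{_ : NonZero d}} xs ys →
      Pointwise _∼_ (repeatEach d xs) (repeatEach d ys) → Pointwise _∼_ xs ys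
    repeatEach⁻ d@(suc d′) []       []       []            = []
    repeatEach⁻ d@(suc d′) (x ∷ xs) (y ∷ ys) (x∼y ∷ rest) =
      x∼y ∷ repeatEach⁻ d xs ys (replicate-++-cancelˡ d′ rest)

module _ {c ℓ₁ ℓ₂} (R : OrderedCommRing c ℓ₁ ℓ₂) where

  open OrderedCommRing R hiding (_<_; _≤_)

  -- rebound only to give it the usual fixity (Defs declares none)
  infix 4 _≤_
  _≤_ : Rel Carrier ℓ₂
  _≤_ = OrderedCommRing._≤_ R

  open IsTotalOrder isTotalOrder using (total; ≲-respˡ-≈; ≲-respʳ-≈)
    renaming (trans to ≤-trans; reflexive to ≤-reflexive)
  open import Algebra.Properties.CommutativeMonoid.Mult +-commutativeMonoid
    using (_×_; ×-congʳ; ×-congˡ; ×-homo-+; ×-assocˡ; ×-distrib-+)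
  open import Algebra.Properties.Group +-group using (//-rightDividesʳ)
  open import Relation.Binary.Reasoning.Setoid setoid

  ≤-resp₂-≈ : ∀ {x x′ y y′} → x ≈ x′ → y ≈ y′ → x ≤ y → x′ ≤ y′
  ≤-resp₂-≈ x≈x′ y≈y′ x≤y = ≲-respˡ-≈ x≈x′ (≲-respʳ-≈ y≈y′ x≤y)

  +-mono₂-≤ : ∀ {x y u v} → x ≤ y → u ≤ v → x + u ≤ y + v
  +-mono₂-≤ {x} {y} {u} {v} x≤y u≤v =
    ≤-trans (+-mono-≤ u x≤y) (≤-resp₂-≈ (+-comm u y) (+-comm v y) (+-mono-≤ y u≤v))

  +-cancelʳ-≤ : ∀ {x y} w → x + w ≤ y + w → x ≤ y
  +-cancelʳ-≤ {x} {y} w x+w≤y+w =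
    ≤-resp₂-≈ (//-rightDividesʳ w x) (//-rightDividesʳ w y) (+-mono-≤ (- w) x+w≤y+w)

  ×-zeroʳ : ∀ n → n × 0# ≈ 0#
  ×-zeroʳ zero    = refl
  ×-zeroʳ (suc n) = trans (+-identityˡ _) (×-zeroʳ n)

  +-×-zeroʳ : ∀ n x → x + n × 0# ≈ x
  +-×-zeroʳ n x = trans (+-congˡ (×-zeroʳ n)) (+-identityʳ x)

  ×-monoʳ-≤ : ∀ n {x y} → x ≤ y → n × x ≤ n × y
  ×-monoʳ-≤ zero    x≤y = ≤-reflexive refl
  ×-monoʳ-≤ (suc n) x≤y = +-mono₂-≤ x≤y (×-monoʳ-≤ n x≤y)

  -- Needs totality: if y ≤ x, then x + n·x ≤ y + n·y ≤ y + n·x.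
  ×-cancelˡ-≤ : ∀ n .{{_ : NonZero n}} {x y} → n × x ≤ n × y → x ≤ y
  ×-cancelˡ-≤ (suc n) {x} {y} nx≤ny with total x y
  ... | inj₁ x≤y = x≤y
  ... | inj₂ y≤x =
    +-cancelʳ-≤ (n × x) (≤-trans nx≤ny (+-mono₂-≤ (≤-reflexive refl) (×-monoʳ-≤ n y≤x)))

  -- α + k·x on the segment from α to α + (k+m)·x as a convex combination of
  -- its endpoints, with the denominator k + m cleared.
  ×-convex-split : ∀ k m α x → (k ℕ.+ m) × (α + k × x) ≈ m × α + k × (α + (k ℕ.+ m) × x)
  ×-convex-split k m α x = begin
    (k ℕ.+ m) × (α + k × x)                 ≈⟨ ×-distrib-+ α (k × x) (k ℕ.+ m) ⟩
    (k ℕ.+ m) × α + (k ℕ.+ m) × (k × x)     ≈⟨ +-cong (×-homo-+ α k m) (×-assocˡ x (k ℕ.+ m) k) ⟩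
    (k × α + m × α) + ((k ℕ.+ m) ℕ.* k) × x  ≈⟨ +-cong (+-comm (k × α) (m × α)) (×-congˡ (ℕ.*-comm (k ℕ.+ m) k)) ⟩
    (m × α + k × α) + (k ℕ.* (k ℕ.+ m)) × x  ≈⟨ +-assoc (m × α) (k × α) _ ⟩
    m × α + (k × α + (k ℕ.* (k ℕ.+ m)) × x)  ≈⟨ +-congˡ (+-congˡ (×-assocˡ x k (k ℕ.+ m))) ⟨
    m × α + (k × α + k × ((k ℕ.+ m) × x))   ≈⟨ +-congˡ (×-distrib-+ α ((k ℕ.+ m) × x) k) ⟨
    m × α + k × (α + (k ℕ.+ m) × x)         ∎

  ×-interpolate-≤ : ∀ {k d α β x y} → k ℕ.≤ d →
    α ≤ β → α + d × x ≤ β + d × y → α + k × x ≤ β + k × y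
  ×-interpolate-≤ {zero}  _   α≤β _ = +-mono-≤ 0# α≤β
  ×-interpolate-≤ {k@(suc _)} {α = α} {β} {x} {y} k≤d α≤β αx≤βy with ℕ.m≤n⇒∃[o]m+o≡n k≤d
  ... | m , ≡.refl = ×-cancelˡ-≤ (k ℕ.+ m)
    (≤-resp₂-≈ (sym (×-convex-split k m α x)) (sym (×-convex-split k m β y))
      (+-mono₂-≤ (×-monoʳ-≤ m α≤β) (×-monoʳ-≤ k αx≤βy)))

  Σ-++ : ∀ xs ys → Σ R (xs ++ ys) ≈ Σ R xs + Σ R ys
  Σ-++ []       ys = sym (+-identityˡ (Σ R ys))
  Σ-++ (x ∷ xs) ys = trans (+-congˡ (Σ-++ xs ys)) (sym (+-assoc x (Σ R xs) (Σ R ys)))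

  Σ-replicate : ∀ k x → Σ R (replicate k x) ≈ k × x
  Σ-replicate zero    x = refl
  Σ-replicate (suc k) x = +-congˡ (Σ-replicate k x)

  Σ-replicate-++ : ∀ k x ys → Σ R (replicate k x ++ ys) ≈ k × x + Σ R ys
  Σ-replicate-++ k x ys = trans (Σ-++ (replicate k x) ys) (+-congʳ (Σ-replicate k x))

  Σ-repeatEach : ∀ d xs → Σ R (repeatEach d xs) ≈ d × Σ R xs
  Σ-repeatEach d []       = sym (×-zeroʳ d)
  Σ-repeatEach d (x ∷ xs) = begin
    Σ R (replicate d x ++ repeatEach d xs) ≈⟨ Σ-replicate-++ d x (repeatEach d xs) ⟩
    d × x + Σ R (repeatEach d xs)          ≈⟨ +-congˡ (Σ-repeatEach d xs) ⟩
    d × x + d × Σ R xs                     ≈⟨ ×-distrib-+ x (Σ R xs) d ⟨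
    d × (x + Σ R xs)                       ∎

  Σ-take-repeatEach : ∀ d q xs → Σ R (take (q ℕ.* d) (repeatEach d xs)) ≈ d × Σ R (take q xs)
  Σ-take-repeatEach d q xs =
    trans (reflexive (cong (Σ R) (take-repeatEach d q xs))) (Σ-repeatEach d (take q xs))

  Σ-take-replicate-++ : ∀ {k m} x ys → k ℕ.≤ m → Σ R (take k (replicate m x ++ ys)) ≈ k × x
  Σ-take-replicate-++ {k} x ys k≤m =
    trans (reflexive (cong (Σ R) (take-replicate-++ x ys k≤m))) (Σ-replicate k x)

  Σ-take-replicate-++-+ : ∀ m k x ys → Σ R (take (m ℕ.+ k) (replicate m x ++ ys)) ≈ m × x + Σ R (take k ys)
  Σ-take-replicate-++-+ m k x ys =
    trans (reflexive (cong (Σ R) (take-replicate-++-+ m k x ys))) (Σ-replicate-++ m x (take k ys))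

  PrefixSums-≤ : List Carrier → List Carrier → Set ℓ₂
  PrefixSums-≤ s t = ∀ k → Σ R (take k s) ≤ Σ R (take k t)

  -- α and β are the sums of the blocks of repeatEach d s and repeatEach d t
  -- already passed; inside a block the prefix sums are affine in k.
  repeatEach-prefixSums-≤-from : ∀ d {α β} s t → length s ≡ length t →
    (∀ q → α + d × Σ R (take q s) ≤ β + d × Σ R (take q t)) →
    ∀ k → α + Σ R (take k (repeatEach d s)) ≤ β + Σ R (take k (repeatEach d t))
  repeatEach-prefixSums-≤-from d {α} {β} [] [] _ αs≤βt k =
    ≤-resp₂-≈ (empty α) (empty β) (αs≤βt 0)
    where
    empty : ∀ γ → γ + d × 0# ≈ γ + Σ R (take k [])
    empty γ = +-congˡ (trans (×-zeroʳ d) (reflexive (cong (Σ R) (≡.sym (take-[] k)))))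
  repeatEach-prefixSums-≤-from d {α} {β} (x ∷ s) (y ∷ t) |s|≡|t| αs≤βt k with ℕ.≤-total k d
  ... | inj₁ k≤d =
    ≤-resp₂-≈ (+-congˡ (sym (Σ-take-replicate-++ x _ k≤d)))
              (+-congˡ (sym (Σ-take-replicate-++ y _ k≤d)))
      (×-interpolate-≤ k≤d α≤β αx≤βy)
    where
    α≤β : α ≤ β
    α≤β = ≤-resp₂-≈ (+-×-zeroʳ d α) (+-×-zeroʳ d β) (αs≤βt 0)
    αx≤βy : α + d × x ≤ β + d × y
    αx≤βy = ≤-resp₂-≈ (+-congˡ (×-congʳ d (+-identityʳ x))) (+-congˡ (×-congʳ d (+-identityʳ y)))
                      (αs≤βt 1)
  ... | inj₂ d≤k with ℕ.m≤n⇒∃[o]m+o≡n d≤k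
  ...   | j , ≡.refl =
    ≤-resp₂-≈ (block α x s) (block β y t)
      (repeatEach-prefixSums-≤-from d s t (ℕ.suc-injective |s|≡|t|) (λ q →
        ≤-resp₂-≈ (unblock α x s q) (unblock β y t q) (αs≤βt (suc q))) j)
    where
    block : ∀ γ z r → (γ + d × z) + Σ R (take j (repeatEach d r))
                      ≈ γ + Σ R (take (d ℕ.+ j) (repeatEach d (z ∷ r)))
    block γ z r =
      trans (+-assoc γ (d × z) _) (+-congˡ (sym (Σ-take-replicate-++-+ d j z (repeatEach d r))))
    unblock : ∀ γ z r q → γ + d × Σ R (take (suc q) (z ∷ r)) ≈ (γ + d × z) + d × Σ R (take q r)
    unblock γ z r q = trans (+-congˡ (×-distrib-+ z _ d)) (sym (+-assoc γ (d × z) _))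

  repeatEach-prefixSums-≤ : ∀ d {s t} → length s ≡ length t →
    PrefixSums-≤ s t → PrefixSums-≤ (repeatEach d s) (repeatEach d t)
  repeatEach-prefixSums-≤ d {s} {t} |s|≡|t| s≤t k =
    ≤-resp₂-≈ (+-identityˡ _) (+-identityˡ _)
      (repeatEach-prefixSums-≤-from d s t |s|≡|t|
        (λ q → ≤-resp₂-≈ (sym (+-identityˡ _)) (sym (+-identityˡ _)) (×-monoʳ-≤ d (s≤t q))) k)

  -- ≻ leaves the prefixes of length 0 and ≥ length s unconstrained; for the
  -- latter, the equality of the total sums is needed.
  ≻⇒prefixSums-≤ : ∀ {s t} → length s ≡ length t → Σ R s ≈ Σ R t → _≻_ R s t → PrefixSums-≤ s t
  ≻⇒prefixSums-≤ _ _ _ zero = ≤-reflexive refl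
  ≻⇒prefixSums-≤ {s} {t} |s|≡|t| Σs≈Σt (_ , s≤t) (suc q) with suc q ℕ.<? length s
  ... | yes q<|s| = s≤t (suc q) (s≤s z≤n) q<|s|
  ... | no  q≮|s| = ≤-reflexive (begin
    Σ R (take (suc q) s) ≡⟨ cong (Σ R) (take-all (suc q) s |s|≤q) ⟩
    Σ R s                ≈⟨ Σs≈Σt ⟩
    Σ R t                ≡⟨ cong (Σ R) (take-all (suc q) t (≡.subst (ℕ._≤ suc q) |s|≡|t| |s|≤q)) ⟨
    Σ R (take (suc q) t) ∎)
    where
    |s|≤q : length s ℕ.≤ suc q
    |s|≤q = ℕ.≮⇒≥ q≮|s|

  ≻-repeatEach : ∀ d .{{_ : NonZero d}} {s t} → length s ≡ length t → Σ R s ≈ Σ R t →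
    _≻_ R s t ⇔ _≻_ R (repeatEach d s) (repeatEach d t)
  ≻-repeatEach d {s} {t} |s|≡|t| Σs≈Σt = mk⇔ stretch shrink
    where
    stretch : _≻_ R s t → _≻_ R (repeatEach d s) (repeatEach d t)
    stretch s≻t@(s≉t , _) =
        s≉t ∘ repeatEach⁻ d s t
      , λ k _ _ → repeatEach-prefixSums-≤ d |s|≡|t| (≻⇒prefixSums-≤ |s|≡|t| Σs≈Σt s≻t) k
    shrink : _≻_ R (repeatEach d s) (repeatEach d t) → _≻_ R s t
    shrink (ds≉dt , ds≤dt) =
        ds≉dt ∘ repeatEach⁺ d
      , λ q 1≤q q<|s| → ×-cancelˡ-≤ d
          (≤-resp₂-≈ (Σ-take-repeatEach d q s) (Σ-take-repeatEach d q t)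
            (ds≤dt (q ℕ.* d) (ℕ.≤-trans 1≤q (ℕ.m≤m*n q d))
              (≡.subst (q ℕ.* d ℕ.<_) (≡.sym (length-repeatEach d s)) (ℕ.*-monoˡ-< d q<|s|))))

  •≡× : ∀ n x → _•_ R n x ≡ n × x
  •≡× zero    x = ≡.refl
  •≡× (suc n) x = cong (x +_) (•≡× n x)

  Σ-incl : ∀ p z → Σ R (incl R p z) ≈ weightedSum R p z
  Σ-incl []      z       = refl
  Σ-incl (m ∷ p) []      = refl
  Σ-incl (m ∷ p) (x ∷ z) = begin
    Σ R (replicate m x ++ incl R p z) ≈⟨ Σ-replicate-++ m x (incl R p z) ⟩
    m × x + Σ R (incl R p z)          ≈⟨ +-cong (reflexive (≡.sym (•≡× m x))) (Σ-incl p z) ⟩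
    _•_ R m x + weightedSum R p z     ∎

  length-incl : ∀ p z → length z ≡ length p → length (incl R p z) ≡ foldr ℕ._+_ 0 p
  length-incl []      []      _       = ≡.refl
  length-incl (m ∷ p) (x ∷ z) |z|≡|p| =
    ≡.trans (length-++ (replicate m x))
            (cong₂ ℕ._+_ (length-replicate m) (length-incl p z (ℕ.suc-injective |z|≡|p|)))

  incl-map-* : ∀ d p z → incl R (map (ℕ._* d) p) z ≡ repeatEach d (incl R p z)
  incl-map-* d []      z       = ≡.refl
  incl-map-* d (m ∷ p) []      = ≡.refl
  incl-map-* d (m ∷ p) (x ∷ z) =
    ≡.trans (cong₂ _++_ (replicate-* m d x) (incl-map-* d p z))
            (≡.sym (concatMap-++ (replicate d) (replicate m x) (incl R p z)))

  module _ {n p z} (admissible : Admissible R n p z) where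
    open Admissible admissible

    length-ι′ : length (ι′ R p z) ≡ n
    length-ι′ = ≡.trans (length-incl p z len) parts-sum

    Σ-ι′ : Σ R (ι′ R p z) ≈ 0#
    Σ-ι′ = trans (Σ-incl p z) weighted-0

lemma4p5 : ∀ {c ℓ₁ ℓ₂ : Level} (R : OrderedCommRing c ℓ₁ ℓ₂) (d n : ℕ) → 1 < d →
    (p₁ p₂ : List ℕ) (z₁ z₂ : List (OrderedCommRing.Carrier R)) →
    Admissible R n p₁ z₁ → Admissible R n p₂ z₂ →
    (_≻_ R (ι′ R p₁ z₁) (ι′ R p₂ z₂) ⇔ _≻_ R (ιG R d p₁ z₁) (ιG R d p₂ z₂))
lemma4p5 R d n 1<d p₁ p₂ z₁ z₂ A₁ A₂ =
  ≡.subst₂ (λ u v → _≻_ R (ι′ R p₁ z₁) (ι′ R p₂ z₂) ⇔ _≻_ R u v)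
    (≡.sym (incl-map-* R d p₁ z₁)) (≡.sym (incl-map-* R d p₂ z₂))
    (≻-repeatEach R d {{d-nonZero}} equal-lengths equal-sums)
  where
  open OrderedCommRing R using (_≈_; trans; sym)
  d-nonZero : NonZero d
  d-nonZero = ℕ.>-nonZero (ℕ.<-trans ℕ.z<s 1<d)
  equal-lengths : length (ι′ R p₁ z₁) ≡ length (ι′ R p₂ z₂)
  equal-lengths = ≡.trans (length-ι′ R A₁) (≡.sym (length-ι′ R A₂))
  equal-sums : Σ R (ι′ R p₁ z₁) ≈ Σ R (ι′ R p₂ z₂)
  equal-sums = trans (Σ-ι′ R A₁) (sym (Σ-ι′ R A₂))
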